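{- Let $S$ be an infinite additive abelian semigroup and let $A$ be a subset of $S$. If $A$ is a maximal nonbasis of order $h$ for $S$ and $(A_q)_{q=1}^{\infty}$ is an asymptotically strictly decreasing sequence of subsets of $S$ such that $A = \bigcap_{q=1}^{\infty} A_q$, then \[ hA \neq \bigcap_{q=1}^{\infty} hA_q. \]
   Context: For a subset $A$ of an additive abelian semigroup $S$ and a positive integer $h$, $hA = \{a_1+\cdots+a_h : a_i \in A \text{ for all } i\}$ is the $h$-fold sumset. $A$ is a basis of order $h$ for $S$ if $hA = S$. $A$ is a maximal nonbasis of order $h$ for $S$ if $hA \neq S$ but every proper superset $B \supsetneq A$ in $S$ satisfies $hB = S$. A sequence of sets $(A_q)_{q=1}^{\infty}$ is asymptotically strictly decreasing if $A_q \supseteq A_{q+1}$ for all $q$ and $A_q \neq A_{q+1}$ for infinitely many $q$. -}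

module Defs where

open import Data.Nat using (ℕ; zero; suc; _≤_; NonZero)
open import Data.Fin using (Fin; zero; suc)
open import Data.Product using (Σ; ∃; _×_; _,_)
open import Data.Empty using (⊥)
open import Relation.Nullary using (¬_)
open import Relation.Binary.PropositionalEquality using (_≡_)
open import Function.Bundles using (_⇔_)

Subset : Set → Set₁
Subset S = S → Set

_⊆_ : {S : Set} → Subset S → Subset S → Set
A ⊆ B = ∀ x → A x → B x

_≐_ : {S : Set} → Subset S → Subset S → Set
A ≐ B = ∀ x → A x ⇔ B x

_⊋_ : {S : Set} → Subset S → Subset S → Set
B ⊋ A = (A ⊆ B) × ¬ (B ≐ A)

Full : {S : Set} → Subset S
Full _ = Data.Unit.⊤
  where import Data.Unit

-- intersection of a sequence of subsets (indexed by ℕ, q = 0,1,2,…)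
⋂ : {S : Set} → (ℕ → Subset S) → Subset S
⋂ A x = ∀ q → A q x

Finite : Set → Set
Finite S = ∃ λ n → Σ (Fin n → S) λ f → ∀ x → ∃ λ i → f i ≡ x

Infinite : Set → Set
Infinite S = ¬ Finite S

module _ {S : Set} (_+_ : S → S → S) where

  sum : (k : ℕ) → (Fin (suc k) → S) → S
  sum zero a = a zero
  sum (suc k) a = a zero + sum k (λ i → a (suc i))

  sumset : (h : ℕ) → .{{NonZero h}} → Subset S → Subset S
  sumset (suc k) A x = Σ (Fin (suc k) → S) λ a → (∀ i → A (a i)) × (sum k a ≡ x)

  IsBasis : (h : ℕ) → .{{NonZero h}} → Subset S → Set
  IsBasis h A = sumset h A ≐ Full

  IsMaximalNonbasis : (h : ℕ) → .{{NonZero h}} → Subset S → Set₁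
  IsMaximalNonbasis h A = ¬ IsBasis h A × (∀ B → B ⊋ A → IsBasis h B)

AsymptoticallyStrictlyDecreasing : {S : Set} → (ℕ → Subset S) → Set
AsymptoticallyStrictlyDecreasing A =
  (∀ q → A (suc q) ⊆ A q) × (∀ N → ∃ λ q → N ≤ q × ¬ (A q ≐ A (suc q)))

{-# OPTIONS --safe #-}
module Submission where

-- Every A_q properly contains A: if A_q ≐ A, then A ⊆ A_q' ⊆ A_q ≐ A for all q' ≥ q, so the
-- sequence would be constant from q on. By maximality each A_q is therefore a basis of order h,
-- hence ⋂ hA_q is all of S, while hA is not.

open import Defs
open import Data.Nat using (ℕ; NonZero; suc; _≤_; _≤′_; ≤′-refl; ≤′-step)
open import Data.Nat.Properties using (≤⇒≤′)
open import Data.Product using (_,_)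
open import Data.Unit using (tt)
open import Function.Bundles using (mk⇔; Equivalence)
open import Relation.Nullary using (¬_)
open import Relation.Binary.PropositionalEquality using (_≡_)
open import Algebra.Structures using (IsCommutativeSemigroup)

open Equivalence

module _ {S : Set} {As : ℕ → Subset S} (decreasing : ∀ q → As (suc q) ⊆ As q) where

  decreasing⇒antitone : ∀ {q q'} → q ≤ q' → As q' ⊆ As q
  decreasing⇒antitone q≤q' = go (≤⇒≤′ q≤q')
    where
    go : ∀ {q q'} → q ≤′ q' → As q' ⊆ As q
    go ≤′-refl         x x∈As = x∈As
    go (≤′-step q≤′q') x x∈As = go q≤′q' x (decreasing _ x x∈As)

asymptoticallyStrictlyDecreasing⇒⊋lowerBound :
  {S : Set} {A : Subset S} {As : ℕ → Subset S} →
  AsymptoticallyStrictlyDecreasing As → A ⊆ ⋂ As → ∀ q → As q ⊋ A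
asymptoticallyStrictlyDecreasing⇒⊋lowerBound {A = A} {As} (decreasing , strict) A⊆⋂As q =
  A⊆As q , As-q≭A
  where
  A⊆As : ∀ q → A ⊆ As q
  A⊆As q x x∈A = A⊆⋂As x x∈A q

  As-q≭A : ¬ (As q ≐ A)
  As-q≭A As-q≐A with strict q
  ... | q' , q≤q' , As-q'≭As-q'+1 = As-q'≭As-q'+1 λ x → mk⇔
    (λ x∈As-q' → A⊆As (suc q') x (to (As-q≐A x) (decreasing⇒antitone decreasing q≤q' x x∈As-q')))
    (decreasing q' x)

module _ {S : Set} (_+_ : S → S → S) (h : ℕ) .{{_ : NonZero h}} where

  ⋂-bases⇒⋂sumset-full : {As : ℕ → Subset S} → (∀ q → IsBasis _+_ h (As q)) →
                          ⋂ (λ q → sumset _+_ h (As q)) ≐ Full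
  ⋂-bases⇒⋂sumset-full bases x = mk⇔ (λ _ → tt) (λ _ q → from (bases q x) tt)

mainTheorem5 : (S : Set) (_+_ : S → S → S) → IsCommutativeSemigroup _≡_ _+_ → Infinite S → (h : ℕ) → .{{_ : NonZero h}} → (A : Subset S) → (As : ℕ → Subset S) → IsMaximalNonbasis _+_ h A → AsymptoticallyStrictlyDecreasing As → A ≐ ⋂ As → ¬ (sumset _+_ h A ≐ ⋂ (λ q → sumset _+_ h (As q)))
mainTheorem5 S _+_ _ _ h A As (notBasis , maximal) asd A≐⋂As hA≐⋂hAs =
  notBasis λ x → mk⇔ (λ _ → tt) (λ _ → from (hA≐⋂hAs x) (from (⋂hAs-full x) tt))
  where
  As-basis : ∀ q → IsBasis _+_ h (As q)
  As-basis q = maximal (As q)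
    (asymptoticallyStrictlyDecreasing⇒⊋lowerBound asd (λ x → to (A≐⋂As x)) q)

  ⋂hAs-full : ⋂ (λ q → sumset _+_ h (As q)) ≐ Full
  ⋂hAs-full = ⋂-bases⇒⋂sumset-full _+_ h As-basis
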